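{- Let $m\geq 1$ and let $n\geq l\geq 1$ be integers, and let $X_1,\dots,X_m$ be elements of a commutative ring (e.g. indeterminates). For $i=1,\dots,m$ let $\mathbf{A}_i$ be the $l\times ml$ matrix whose entry in row $k$ and column $j$ ($1\le k\le l$, $1\le j\le ml$) is $\binom{n+j-1}{k-1}X_i^{j-1}$, i.e. $$\mathbf{A}_i=\begin{bmatrix}\binom{n}{0} & \binom{n+1}{0}X_i & \cdots & \binom{n+ml-1}{0}X_i^{ml-1}\\ \binom{n}{1} & \binom{n+1}{1}X_i & \cdots & \binom{n+ml-1}{1}X_i^{ml-1}\\ \vdots & \vdots & \ddots & \vdots\\ \binom{n}{l-1} & \binom{n+1}{l-1}X_i & \cdots & \binom{n+ml-1}{l-1}X_i^{ml-1}\end{bmatrix}.$$ Let $\mathbf{A}$ be the $ml\times ml$ matrix obtained by stacking $\mathbf{A}_1,\mathbf{A}_2,\dots,\mathbf{A}_m$ vertically in this order. Then $$\det\mathbf{A}=\prod_{i=1}^m X_i^{\frac{l(l-1)}{2}}\prod_{1\leq i<j\leq m}(X_j-X_i)^{l^2}.$$ -}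

module Defs where

open import Level using (Level)
open import Algebra.Bundles using (CommutativeRing)
open import Data.Nat as ℕ using (ℕ; zero; suc)
open import Data.Nat.Combinatorics using (_C_)
open import Data.Fin as Fin using (Fin; zero; suc; toℕ; punchIn; remQuot)
open import Data.Product using (proj₁; proj₂)
open import Relation.Nullary using (yes; no)

module _ {c ℓ : Level} (R : CommutativeRing c ℓ) where
  open CommutativeRing R hiding (zero)

  ℕ→R : ℕ → Carrier
  ℕ→R zero    = 0#
  ℕ→R (suc k) = 1# + ℕ→R k

  pow : Carrier → ℕ → Carrier
  pow x zero    = 1#
  pow x (suc k) = x * pow x k

  sign : ℕ → Carrier
  sign zero    = 1#
  sign (suc k) = - sign k

  ∑ : ∀ k → (Fin k → Carrier) → Carrier
  ∑ zero    f = 0#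
  ∑ (suc k) f = f zero + ∑ k (λ i → f (suc i))

  ∏ : ∀ k → (Fin k → Carrier) → Carrier
  ∏ zero    f = 1#
  ∏ (suc k) f = f zero * ∏ k (λ i → f (suc i))

  det : ∀ k → (Fin k → Fin k → Carrier) → Carrier
  det zero    M = 1#
  det (suc k) M =
    ∑ (suc k) (λ j → sign (toℕ j) * (M zero j * det k (λ r s → M (suc r) (punchIn j s))))

  -- The matrix A of the theorem (0-based indices).  Row index r ∈ Fin (m*l)
  -- corresponds to block i = quotient and row k = remainder (r = i*l + k),
  -- i.e. A_1,...,A_m stacked vertically in this order.
  matA : (m l n : ℕ) (X : Fin m → Carrier) → Fin (m ℕ.* l) → Fin (m ℕ.* l) → Carrier
  matA m l n X r j =
    ℕ→R ((n ℕ.+ toℕ j) C toℕ (proj₂ (remQuot {m} l r))) * pow (X (proj₁ (remQuot {m} l r))) (toℕ j)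

  DiffFactor : ∀ {m} (X : Fin m → Carrier) (l : ℕ) → Fin m → Fin m → Carrier
  DiffFactor X l i j with toℕ i ℕ.<? toℕ j
  ... | yes _ = pow (X j - X i) (l ℕ.* l)
  ... | no  _ = 1#

-- Row (i, k) of A, as a function of the column index J, is C(n + J, k) X_i^J = (T^J b)(k), where
-- b k = C(n, k) and T g = X_i (g + shift g) is Pascal's rule scaled by X_i.  For s = 0, 1, …, ml − 1
-- in turn, subtract α_s times column J − 1 from every column J > s, where α_s is the variable of the
-- block containing row s; this keeps the determinant, and afterwards column J of row (i, k) is
-- ((T − α_{J−1}) ⋯ (T − α_0) b)(k).  Since T − X_i = X_i shift, the factors coming from block i make
-- this vanish for J > il + k, and on the diagonal it equals X_i^k ∏_{t < il} (X_i − α_t).  The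
-- determinant of the resulting lower triangular matrix is the product of these entries.

module Submission where

open import Defs
open import Level using (Level)
open import Algebra.Bundles using (CommutativeRing)
open import Data.Nat as ℕ using (ℕ; zero; suc; _≤_; _<_; _∸_; _/_)
open import Data.Nat.DivMod using (+-distrib-/-∣ˡ; +-distrib-/-∣ʳ; m<n⇒m/n≡0; m*n/n≡m)
open import Data.Nat.Divisibility using (divides-refl)
open import Data.Nat.Tactic.RingSolver using (solve-∀)
open import Data.Nat.Combinatorics using (_C_; nCk+nC[k+1]≡[n+1]C[k+1])
import Data.Nat.Properties as ℕ
open import Data.Fin as Fin using (Fin; zero; suc; toℕ; _↑ˡ_; _↑ʳ_; combine; punchIn; punchOut)
import Data.Fin.Properties as Fin
open import Function using (_∘_)
open import Relation.Nullary using (yes; no; ¬_)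
open import Data.Empty using (⊥-elim)
open import Data.Product using (_×_; _,_; proj₁; proj₂; uncurry)
open import Data.Sum using (_⊎_; inj₁; inj₂)
open import Relation.Binary.PropositionalEquality as ≡ using (_≡_; _≢_)

[n*q+r]/n≡q : ∀ n q r .{{_ : ℕ.NonZero n}} → r < n → (n ℕ.* q ℕ.+ r) / n ≡ q
[n*q+r]/n≡q n q r r<n = begin-equality
  (n ℕ.* q ℕ.+ r) / n   ≡⟨ ≡.cong (_/ n) (≡.trans (ℕ.+-comm (n ℕ.* q) r) (≡.cong (r ℕ.+_) (ℕ.*-comm n q))) ⟩
  (r ℕ.+ q ℕ.* n) / n   ≡⟨ +-distrib-/-∣ʳ r (divides-refl q) ⟩
  r / n ℕ.+ q ℕ.* n / n ≡⟨ ≡.cong₂ ℕ._+_ (m<n⇒m/n≡0 r<n) (m*n/n≡m q n) ⟩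
  q                     ∎
  where open ℕ.≤-Reasoning

n+n[n∸1]/2≡[n+1]n/2 : ∀ n → n ℕ.+ n ℕ.* (n ∸ 1) / 2 ≡ suc n ℕ.* n / 2
n+n[n∸1]/2≡[n+1]n/2 n = begin-equality
  n ℕ.+ n ℕ.* (n ∸ 1) / 2         ≡⟨ ≡.cong (ℕ._+ n ℕ.* (n ∸ 1) / 2) (≡.sym (m*n/n≡m n 2)) ⟩
  n ℕ.* 2 / 2 ℕ.+ n ℕ.* (n ∸ 1) / 2 ≡⟨ ≡.sym (+-distrib-/-∣ˡ (n ℕ.* (n ∸ 1)) (divides-refl n)) ⟩
  (n ℕ.* 2 ℕ.+ n ℕ.* (n ∸ 1)) / 2   ≡⟨ ≡.cong (_/ 2) (expand n) ⟩
  suc n ℕ.* n / 2                   ∎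
  where
  open ℕ.≤-Reasoning
  expand : ∀ n → n ℕ.* 2 ℕ.+ n ℕ.* (n ∸ 1) ≡ suc n ℕ.* n
  expand zero    = ≡.refl
  expand (suc p) = identity p
    where
    identity : ∀ p → suc p ℕ.* 2 ℕ.+ suc p ℕ.* p ≡ suc (suc p) ℕ.* suc p
    identity = solve-∀

punchOut-adjacent : ∀ {n} (c a b : Fin (suc n)) (c≢a : c ≢ a) (c≢b : c ≢ b) → toℕ b ≡ suc (toℕ a) →
                    toℕ (punchOut c≢b) ≡ suc (toℕ (punchOut c≢a))
punchOut-adjacent zero    zero    _       c≢a _   _ = ⊥-elim (c≢a ≡.refl)
punchOut-adjacent zero    (suc a) (suc b) _   _   b=a+1 = ℕ.suc-injective b=a+1
punchOut-adjacent {suc n} (suc zero) zero (suc zero) _ c≢b _ = ⊥-elim (c≢b ≡.refl)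
punchOut-adjacent {suc (suc n)} (suc (suc c)) zero (suc zero) _ _ _ = ≡.refl
punchOut-adjacent {suc n} (suc c) (suc a) (suc b) c≢a c≢b b=a+1 =
  ≡.cong suc (punchOut-adjacent c a b (c≢a ∘ ≡.cong suc) (c≢b ∘ ≡.cong suc) (ℕ.suc-injective b=a+1))

punchIn-adjacent : ∀ {n} (a b : Fin (suc n)) (s : Fin n) → toℕ b ≡ suc (toℕ a) →
                   punchIn a s ≡ punchIn b s ⊎ (punchIn a s ≡ b × punchIn b s ≡ a)
punchIn-adjacent zero    (suc zero) zero    _     = inj₂ (≡.refl , ≡.refl)
punchIn-adjacent zero    (suc zero) (suc s) _     = inj₁ ≡.refl
punchIn-adjacent (suc a) (suc b)    zero    _     = inj₁ ≡.refl
punchIn-adjacent (suc a) (suc b)    (suc s) b=a+1 with punchIn-adjacent a b s (ℕ.suc-injective b=a+1)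
... | inj₁ eq          = inj₁ (≡.cong suc eq)
... | inj₂ (eq₁ , eq₂) = inj₂ (≡.cong suc eq₁ , ≡.cong suc eq₂)

module _ {c ℓ : Level} (R : CommutativeRing c ℓ) where
  open CommutativeRing R hiding (zero)
  open import Algebra.Solver.Ring.NaturalCoefficients.Default commutativeSemiring
    using (solve; _:=_; _:+_; _:*_; con)
  open import Relation.Binary.Reasoning.Setoid setoid

  ∑-cong : ∀ k {f g : Fin k → Carrier} → (∀ i → f i ≈ g i) → ∑ R k f ≈ ∑ R k g
  ∑-cong zero    f≈g = refl
  ∑-cong (suc k) f≈g = +-cong (f≈g zero) (∑-cong k (f≈g ∘ suc))

  ∑-zeros : ∀ k (f : Fin k → Carrier) → (∀ i → f i ≈ 0#) → ∑ R k f ≈ 0#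
  ∑-zeros zero    f f≈0 = refl
  ∑-zeros (suc k) f f≈0 = trans (+-cong (f≈0 zero) (∑-zeros k (f ∘ suc) (f≈0 ∘ suc))) (+-identityˡ 0#)

  ∑-linear : ∀ k (f g : Fin k → Carrier) t → ∑ R k (λ i → f i + t * g i) ≈ ∑ R k f + t * ∑ R k g
  ∑-linear zero    f g t = sym (trans (+-congˡ (zeroʳ t)) (+-identityʳ 0#))
  ∑-linear (suc k) f g t = trans (+-congˡ (∑-linear k (f ∘ suc) (g ∘ suc) t))
    (solve 5 (λ a b t F G → (a :+ t :* b) :+ (F :+ t :* G) := (a :+ F) :+ t :* (b :+ G))
      refl (f zero) (g zero) t (∑ R k (f ∘ suc)) (∑ R k (g ∘ suc)))

  ∏-cong : ∀ k {f g : Fin k → Carrier} → (∀ i → f i ≈ g i) → ∏ R k f ≈ ∏ R k g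
  ∏-cong zero    f≈g = refl
  ∏-cong (suc k) f≈g = *-cong (f≈g zero) (∏-cong k (f≈g ∘ suc))

  ∏-split : ∀ a b (f : Fin (a ℕ.+ b) → Carrier) →
            ∏ R (a ℕ.+ b) f ≈ ∏ R a (λ i → f (i ↑ˡ b)) * ∏ R b (λ j → f (a ↑ʳ j))
  ∏-split zero    b f = sym (*-identityˡ _)
  ∏-split (suc a) b f = trans (*-congˡ (∏-split a b (f ∘ suc))) (sym (*-assoc _ _ _))

  ∏-combine : ∀ m l (f : Fin (m ℕ.* l) → Carrier) →
              ∏ R (m ℕ.* l) f ≈ ∏ R m (λ i → ∏ R l (λ k → f (combine i k)))
  ∏-combine zero    l f = refl
  ∏-combine (suc m) l f = trans (∏-split l (m ℕ.* l) f) (*-congˡ (∏-combine m l (f ∘ (l ↑ʳ_))))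

  ∏-distrib-* : ∀ k (f g : Fin k → Carrier) → ∏ R k (λ i → f i * g i) ≈ ∏ R k f * ∏ R k g
  ∏-distrib-* zero    f g = sym (*-identityˡ 1#)
  ∏-distrib-* (suc k) f g = trans (*-congˡ (∏-distrib-* k (f ∘ suc) (g ∘ suc)))
    (solve 4 (λ a b F G → (a :* b) :* (F :* G) := (a :* F) :* (b :* G)) refl _ _ _ _)

  ∏-const : ∀ k x → ∏ R k (λ _ → x) ≈ pow R x k
  ∏-const zero    x = refl
  ∏-const (suc k) x = *-congˡ (∏-const k x)

  pow-1# : ∀ e → pow R 1# e ≈ 1#
  pow-1# zero    = refl
  pow-1# (suc e) = trans (*-congˡ (pow-1# e)) (*-identityˡ 1#)

  ∏-comm : ∀ a b (F : Fin a → Fin b → Carrier) →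
           ∏ R a (λ i → ∏ R b (F i)) ≈ ∏ R b (λ j → ∏ R a (λ i → F i j))
  ∏-comm zero    b F = sym (trans (∏-const b 1#) (pow-1# b))
  ∏-comm (suc a) b F = trans (*-congˡ (∏-comm a b (F ∘ suc)))
    (sym (∏-distrib-* b (F zero) (λ j → ∏ R a (λ i → F (suc i) j))))

  pow-cong : ∀ e {x y} → x ≈ y → pow R x e ≈ pow R y e
  pow-cong zero    x≈y = refl
  pow-cong (suc e) x≈y = *-cong x≈y (pow-cong e x≈y)

  pow-+ : ∀ x a b → pow R x (a ℕ.+ b) ≈ pow R x a * pow R x b
  pow-+ x zero    b = sym (*-identityˡ _)
  pow-+ x (suc a) b = trans (*-congˡ (pow-+ x a b)) (sym (*-assoc _ _ _))

  pow-distrib-* : ∀ x y e → pow R (x * y) e ≈ pow R x e * pow R y e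
  pow-distrib-* x y zero    = sym (*-identityˡ 1#)
  pow-distrib-* x y (suc e) = trans (*-congˡ (pow-distrib-* x y e))
    (solve 4 (λ a b c d → (a :* b) :* (c :* d) := (a :* c) :* (b :* d)) refl _ _ _ _)

  pow-* : ∀ x a b → pow R x (a ℕ.* b) ≈ pow R (pow R x a) b
  pow-* x a zero    = reflexive (≡.cong (pow R x) (ℕ.*-zeroʳ a))
  pow-* x a (suc b) = begin
    pow R x (a ℕ.* suc b)           ≡⟨ ≡.cong (pow R x) (ℕ.*-suc a b) ⟩
    pow R x (a ℕ.+ a ℕ.* b)         ≈⟨ pow-+ x a (a ℕ.* b) ⟩
    pow R x a * pow R x (a ℕ.* b)   ≈⟨ *-congˡ (pow-* x a b) ⟩
    pow R x a * pow R (pow R x a) b ∎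

  ∏< : ℕ → (ℕ → Carrier) → Carrier
  ∏< zero    f = 1#
  ∏< (suc s) f = f s * ∏< s f

  ∏<-cong : ∀ s {f g : ℕ → Carrier} → (∀ t → t < s → f t ≈ g t) → ∏< s f ≈ ∏< s g
  ∏<-cong zero    f≈g = refl
  ∏<-cong (suc s) f≈g = *-cong (f≈g s (ℕ.n<1+n s)) (∏<-cong s (λ t t<s → f≈g t (ℕ.m<n⇒m<1+n t<s)))

  ∏<-const : ∀ s x → ∏< s (λ _ → x) ≈ pow R x s
  ∏<-const zero    x = refl
  ∏<-const (suc s) x = *-congˡ (∏<-const s x)

  ∏<-split : ∀ a b (f : ℕ → Carrier) → ∏< (a ℕ.+ b) f ≈ ∏< b (λ t → f (a ℕ.+ t)) * ∏< a f
  ∏<-split a zero    f = trans (reflexive (≡.cong (λ s → ∏< s f) (ℕ.+-identityʳ a))) (sym (*-identityˡ _))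
  ∏<-split a (suc b) f = begin
    ∏< (a ℕ.+ suc b) f                                       ≡⟨ ≡.cong (λ s → ∏< s f) (ℕ.+-suc a b) ⟩
    f (a ℕ.+ b) * ∏< (a ℕ.+ b) f                             ≈⟨ *-congˡ (∏<-split a b f) ⟩
    f (a ℕ.+ b) * (∏< b (λ t → f (a ℕ.+ t)) * ∏< a f)        ≈⟨ sym (*-assoc _ _ _) ⟩
    f (a ℕ.+ b) * ∏< b (λ t → f (a ℕ.+ t)) * ∏< a f          ∎

  ∏<-blocks : ∀ l a (f : ℕ → Carrier) → ∏< (l ℕ.* a) f ≈ ∏< a (λ i → ∏< l (λ k → f (l ℕ.* i ℕ.+ k)))
  ∏<-blocks l zero    f = reflexive (≡.cong (λ s → ∏< s f) (ℕ.*-zeroʳ l))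
  ∏<-blocks l (suc a) f = begin
    ∏< (l ℕ.* suc a) f
      ≡⟨ ≡.cong (λ s → ∏< s f) (≡.trans (ℕ.*-suc l a) (ℕ.+-comm l (l ℕ.* a))) ⟩
    ∏< (l ℕ.* a ℕ.+ l) f                                 ≈⟨ ∏<-split (l ℕ.* a) l f ⟩
    ∏< l (λ k → f (l ℕ.* a ℕ.+ k)) * ∏< (l ℕ.* a) f      ≈⟨ *-congˡ (∏<-blocks l a f) ⟩
    ∏< l (λ k → f (l ℕ.* a ℕ.+ k)) * ∏< a (λ i → ∏< l (λ k → f (l ℕ.* i ℕ.+ k))) ∎

  ∏<-suc : ∀ s (f : ℕ → Carrier) → ∏< (suc s) f ≈ f 0 * ∏< s (f ∘ suc)
  ∏<-suc zero    f = refl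
  ∏<-suc (suc s) f = trans (*-congˡ (∏<-suc s f)) (solve 3 (λ a b c → a :* (b :* c) := b :* (a :* c)) refl _ _ _)

  ∏-toℕ : ∀ k (f : ℕ → Carrier) → ∏ R k (f ∘ toℕ) ≈ ∏< k f
  ∏-toℕ zero    f = refl
  ∏-toℕ (suc k) f = trans (*-congˡ (∏-toℕ k (f ∘ suc))) (sym (∏<-suc k f))

  pow-∏< : ∀ s f e → pow R (∏< s f) e ≈ ∏< s (λ t → pow R (f t) e)
  pow-∏< zero    f e = pow-1# e
  pow-∏< (suc s) f e = trans (pow-distrib-* _ _ e) (*-congˡ (pow-∏< s f e))

  Mat : ℕ → Set c
  Mat k = Fin k → Fin k → Carrier

  minor : ∀ {k} → Mat (suc k) → Fin (suc k) → Mat k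
  minor M j r s = M (suc r) (punchIn j s)

  cofactorTerm : ∀ {k} → Mat (suc k) → Fin (suc k) → Carrier
  cofactorTerm {k} M j = sign R (toℕ j) * (M zero j * det R k (minor M j))

  det-cong : ∀ k {M N : Mat k} → (∀ r s → M r s ≈ N r s) → det R k M ≈ det R k N
  det-cong zero    M≈N = refl
  det-cong (suc k) M≈N = ∑-cong (suc k) λ j →
    *-congˡ {sign R (toℕ j)} (*-cong (M≈N zero j) (det-cong k (λ r s → M≈N (suc r) (punchIn j s))))

  det-linear-column : ∀ k (M M₁ M₂ : Mat k) (q : Fin k) (t : Carrier) →
    (∀ r j → j ≢ q → M r j ≈ M₁ r j) → (∀ r j → j ≢ q → M r j ≈ M₂ r j) →
    (∀ r → M r q ≈ M₁ r q + t * M₂ r q) → det R k M ≈ det R k M₁ + t * det R k M₂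
  det-linear-column (suc k) M M₁ M₂ q t M≈M₁ M≈M₂ Mq =
    trans (∑-cong (suc k) term) (∑-linear (suc k) (cofactorTerm M₁) (cofactorTerm M₂) t)
    where
    term : ∀ j → cofactorTerm M j ≈ cofactorTerm M₁ j + t * cofactorTerm M₂ j
    term j with j Fin.≟ q
    ... | yes ≡.refl = begin
      sign R (toℕ j) * (M zero j * det R k (minor M j))
        ≈⟨ *-congˡ (*-cong (Mq zero) (det-cong k (λ r s → M≈M₁ (suc r) (punchIn j s) (Fin.punchInᵢ≢i j s)))) ⟩
      sign R (toℕ j) * ((M₁ zero j + t * M₂ zero j) * det R k (minor M₁ j))
        ≈⟨ solve 5 (λ σ b t q d → σ :* ((b :+ t :* q) :* d) := σ :* (b :* d) :+ t :* (σ :* (q :* d))) refl _ _ _ _ _ ⟩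
      cofactorTerm M₁ j + t * (sign R (toℕ j) * (M₂ zero j * det R k (minor M₁ j)))
        ≈⟨ +-congˡ (*-congˡ (*-congˡ (*-congˡ (det-cong k (λ r s →
             trans (sym (M≈M₁ (suc r) (punchIn j s) (Fin.punchInᵢ≢i j s))) (M≈M₂ (suc r) (punchIn j s) (Fin.punchInᵢ≢i j s))))))) ⟩
      cofactorTerm M₁ j + t * cofactorTerm M₂ j ∎
    ... | no j≢q = begin
      sign R (toℕ j) * (M zero j * det R k (minor M j))
        ≈⟨ *-congˡ (*-cong (M≈M₁ zero j j≢q) minor-linear) ⟩
      sign R (toℕ j) * (M₁ zero j * (det R k (minor M₁ j) + t * det R k (minor M₂ j)))
        ≈⟨ solve 5 (λ σ b t d e → σ :* (b :* (d :+ t :* e)) := σ :* (b :* d) :+ t :* (σ :* (b :* e))) refl _ _ _ _ _ ⟩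
      cofactorTerm M₁ j + t * (sign R (toℕ j) * (M₁ zero j * det R k (minor M₂ j)))
        ≈⟨ +-congˡ (*-congˡ (*-congˡ (*-congʳ (trans (sym (M≈M₁ zero j j≢q)) (M≈M₂ zero j j≢q))))) ⟩
      cofactorTerm M₁ j + t * cofactorTerm M₂ j ∎
      where
      q′ : Fin k
      q′ = punchOut j≢q
      punchIn≢q : ∀ s → s ≢ q′ → punchIn j s ≢ q
      punchIn≢q s s≢q′ eq = s≢q′ (Fin.punchIn-injective j s q′ (≡.trans eq (≡.sym (Fin.punchIn-punchOut j≢q))))
      minor-linear : det R k (minor M j) ≈ det R k (minor M₁ j) + t * det R k (minor M₂ j)
      minor-linear = det-linear-column k (minor M j) (minor M₁ j) (minor M₂ j) q′ t
        (λ r s s≢q′ → M≈M₁ (suc r) (punchIn j s) (punchIn≢q s s≢q′))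
        (λ r s s≢q′ → M≈M₂ (suc r) (punchIn j s) (punchIn≢q s s≢q′))
        (λ r → ≡.subst (λ z → M (suc r) z ≈ M₁ (suc r) z + t * M₂ (suc r) z) (≡.sym (Fin.punchIn-punchOut j≢q)) (Mq (suc r)))

  ∑-adjacent-pair : ∀ k (f : Fin k → Carrier) (a b : Fin k) → toℕ b ≡ suc (toℕ a) → f a + f b ≈ 0# →
                    (∀ c → c ≢ a → c ≢ b → f c ≈ 0#) → ∑ R k f ≈ 0#
  ∑-adjacent-pair (suc (suc k)) f zero (suc zero) _ fa+fb≈0 rest = begin
    f zero + (f (suc zero) + ∑ R k (λ i → f (suc (suc i))))   ≈⟨ sym (+-assoc _ _ _) ⟩
    (f zero + f (suc zero)) + ∑ R k (λ i → f (suc (suc i)))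
      ≈⟨ +-cong fa+fb≈0 (∑-zeros k _ (λ i → rest (suc (suc i)) (λ ()) (λ ()))) ⟩
    0# + 0#                                          ≈⟨ +-identityˡ 0# ⟩
    0#                                               ∎
  ∑-adjacent-pair (suc k) f (suc a) (suc b) b=a+1 fa+fb≈0 rest =
    trans (+-cong (rest zero (λ ()) (λ ()))
                  (∑-adjacent-pair k (f ∘ suc) a b (ℕ.suc-injective b=a+1) fa+fb≈0
                    (λ c c≢a c≢b → rest (suc c) (c≢a ∘ Fin.suc-injective) (c≢b ∘ Fin.suc-injective))))
          (+-identityˡ 0#)

  det-adjacent-columns : ∀ k (M : Mat k) (a b : Fin k) → toℕ b ≡ suc (toℕ a) →
                         (∀ r → M r a ≈ M r b) → det R k M ≈ 0#
  det-adjacent-columns (suc k) M a b b=a+1 Ma≈Mb = ∑-adjacent-pair (suc k) (cofactorTerm M) a b b=a+1 pair-cancels others-vanish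
    where
    same-minor : ∀ r s → minor M a r s ≈ minor M b r s
    same-minor r s with punchIn-adjacent a b s b=a+1
    ... | inj₁ eq          = reflexive (≡.cong (M (suc r)) eq)
    ... | inj₂ (eq₁ , eq₂) = begin
      M (suc r) (punchIn a s) ≡⟨ ≡.cong (M (suc r)) eq₁ ⟩
      M (suc r) b             ≈⟨ sym (Ma≈Mb (suc r)) ⟩
      M (suc r) a             ≡⟨ ≡.cong (M (suc r)) (≡.sym eq₂) ⟩
      M (suc r) (punchIn b s) ∎
    pair-cancels : cofactorTerm M a + cofactorTerm M b ≈ 0#
    pair-cancels = begin
      sign R (toℕ a) * (M zero a * det R k (minor M a)) + sign R (toℕ b) * (M zero b * det R k (minor M b))
        ≈⟨ +-congˡ (*-cong (reflexive (≡.cong (sign R) b=a+1)) (*-cong (sym (Ma≈Mb zero)) (sym (det-cong k same-minor)))) ⟩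
      sign R (toℕ a) * (M zero a * det R k (minor M a)) + - sign R (toℕ a) * (M zero a * det R k (minor M a))
        ≈⟨ sym (distribʳ _ _ _) ⟩
      (sign R (toℕ a) + - sign R (toℕ a)) * (M zero a * det R k (minor M a))
        ≈⟨ trans (*-congʳ (-‿inverseʳ _)) (zeroˡ _) ⟩
      0# ∎
    others-vanish : ∀ c → c ≢ a → c ≢ b → cofactorTerm M c ≈ 0#
    others-vanish c c≢a c≢b = trans (*-congˡ (trans (*-congˡ minor-vanishes) (zeroʳ _))) (zeroʳ _)
      where
      minor-vanishes : det R k (minor M c) ≈ 0#
      minor-vanishes = det-adjacent-columns k (minor M c) (punchOut c≢a) (punchOut c≢b)
        (punchOut-adjacent c a b c≢a c≢b b=a+1)
        (λ r → begin
          M (suc r) (punchIn c (punchOut c≢a)) ≡⟨ ≡.cong (M (suc r)) (Fin.punchIn-punchOut c≢a) ⟩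
          M (suc r) a                           ≈⟨ Ma≈Mb (suc r) ⟩
          M (suc r) b                           ≡⟨ ≡.cong (M (suc r)) (≡.sym (Fin.punchIn-punchOut c≢b)) ⟩
          M (suc r) (punchIn c (punchOut c≢b)) ∎)

  det-add-adjacent-column : ∀ k (M M′ : Mat k) (a b : Fin k) → toℕ b ≡ suc (toℕ a) → (t : Carrier) →
    (∀ r j → j ≢ b → M′ r j ≈ M r j) → (∀ r → M′ r b ≈ M r b + t * M r a) → det R k M′ ≈ det R k M
  det-add-adjacent-column k M M′ a b b=a+1 t M′≈M M′b = begin
    det R k M′
      ≈⟨ det-linear-column k M′ M M[b≔a] b t M′≈M M′≈M[b≔a] (λ r → trans (M′b r) (+-congˡ (*-congˡ (sym (M[b≔a]-column-b r))))) ⟩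
    det R k M + t * det R k M[b≔a]
      ≈⟨ +-congˡ (trans (*-congˡ (det-adjacent-columns k M[b≔a] a b b=a+1 M[b≔a]-equal-columns)) (zeroʳ t)) ⟩
    det R k M + 0#           ≈⟨ +-identityʳ _ ⟩
    det R k M                ∎
    where
    M[b≔a] : Mat k
    M[b≔a] r j with j Fin.≟ b
    ... | yes _ = M r a
    ... | no  _ = M r j
    M[b≔a]-column-b : ∀ r → M[b≔a] r b ≈ M r a
    M[b≔a]-column-b r with b Fin.≟ b
    ... | yes _   = refl
    ... | no  b≢b = ⊥-elim (b≢b ≡.refl)
    M′≈M[b≔a] : ∀ r j → j ≢ b → M′ r j ≈ M[b≔a] r j
    M′≈M[b≔a] r j j≢b with j Fin.≟ b
    ... | yes j≡b = ⊥-elim (j≢b j≡b)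
    ... | no  _   = M′≈M r j j≢b
    M[b≔a]-equal-columns : ∀ r → M[b≔a] r a ≈ M[b≔a] r b
    M[b≔a]-equal-columns r with a Fin.≟ b
    ... | yes a≡b = ⊥-elim (ℕ.1+n≢n (≡.sym (≡.trans (≡.cong toℕ a≡b) b=a+1)))
    ... | no  _   = sym (M[b≔a]-column-b r)

  det-lowerTriangular : ∀ k (M : Mat k) → (∀ r s → toℕ r < toℕ s → M r s ≈ 0#) → det R k M ≈ ∏ R k (λ i → M i i)
  det-lowerTriangular zero    M upper≈0 = refl
  det-lowerTriangular (suc k) M upper≈0 = begin
    1# * (M zero zero * det R k (minor M zero)) + ∑ R k (cofactorTerm M ∘ suc)
      ≈⟨ +-cong (*-identityˡ _) (∑-zeros k _ (λ j → trans (*-congˡ (trans (*-congʳ (upper≈0 zero (suc j) (ℕ.s≤s ℕ.z≤n))) (zeroˡ _))) (zeroʳ _))) ⟩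
    M zero zero * det R k (minor M zero) + 0#
      ≈⟨ +-identityʳ _ ⟩
    M zero zero * det R k (minor M zero)
      ≈⟨ *-congˡ (det-lowerTriangular k (minor M zero) (λ r s r<s → upper≈0 (suc r) (suc s) (ℕ.s≤s r<s))) ⟩
    M zero zero * ∏ R k (λ i → M (suc i) (suc i)) ∎

  Seq : Set c
  Seq = ℕ → Carrier

  columnMatrix : ∀ {k} → (Fin k → Seq) → Mat k
  columnMatrix F r j = F r (toℕ j)

  sweep : ℕ → Carrier → Seq → Seq
  sweep s t g J with J ℕ.≤? s
  ... | yes _ = g J
  ... | no  _ = g J + t * g (ℕ.pred J)

  sweep-≤ : ∀ s t g J → J ≤ s → sweep s t g J ≡ g J
  sweep-≤ s t g J J≤s with J ℕ.≤? s
  ... | yes _   = ≡.refl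
  ... | no  J≰s = ⊥-elim (J≰s J≤s)

  sweep-> : ∀ s t g J → s < J → sweep s t g J ≡ g J + t * g (ℕ.pred J)
  sweep-> s t g J s<J with J ℕ.≤? s
  ... | yes J≤s = ⊥-elim (ℕ.<⇒≱ s<J J≤s)
  ... | no  _   = ≡.refl

  sweep-suc : ∀ s t g J → J ≢ suc s → sweep s t g J ≡ sweep (suc s) t g J
  sweep-suc s t g J J≢1+s with J ℕ.≤? s | J ℕ.≤? suc s
  ... | yes _   | yes _     = ≡.refl
  ... | no  _   | no  _     = ≡.refl
  ... | yes J≤s | no  J≰1+s = ⊥-elim (J≰1+s (ℕ.m≤n⇒m≤1+n J≤s))
  ... | no  J≰s | yes J≤1+s = ⊥-elim (J≢1+s (ℕ.≤-antisym J≤1+s (ℕ.≰⇒> J≰s)))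

  det-sweep : ∀ k (F : Fin k → Seq) s t → det R k (columnMatrix (sweep s t ∘ F)) ≈ det R k (columnMatrix F)
  det-sweep k F s t = go (k ∸ s) s (ℕ.m≤n+m∸n k s)
    where
    unchanged : ∀ u → k ≤ suc u → det R k (columnMatrix (sweep u t ∘ F)) ≈ det R k (columnMatrix F)
    unchanged u k≤1+u = det-cong k (λ r j → reflexive (sweep-≤ u t (F r) (toℕ j) (ℕ.≤-pred (ℕ.≤-trans (Fin.toℕ<n j) k≤1+u))))
    -- sweep u and sweep (suc u) differ only in column u + 1, where sweep u also adds t times column u.
    step : ∀ u → suc u < k → det R k (columnMatrix (sweep u t ∘ F)) ≈ det R k (columnMatrix (sweep (suc u) t ∘ F))
    step u 1+u<k = det-add-adjacent-column k _ _ a b b=a+1 t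
        (λ r j j≢b → reflexive (sweep-suc u t (F r) (toℕ j) (j≢b ∘ toℕ-injective-b j)))
        (λ r → reflexive (column-b (F r)))
      where
      a b : Fin k
      a = Fin.fromℕ< (ℕ.<-trans (ℕ.n<1+n u) 1+u<k)
      b = Fin.fromℕ< 1+u<k
      toℕb : toℕ b ≡ suc u
      toℕb = Fin.toℕ-fromℕ< 1+u<k
      b=a+1 : toℕ b ≡ suc (toℕ a)
      b=a+1 = ≡.trans toℕb (≡.cong suc (≡.sym (Fin.toℕ-fromℕ< _)))
      toℕ-injective-b : ∀ j → toℕ j ≡ suc u → j ≡ b
      toℕ-injective-b j eq = Fin.toℕ-injective (≡.trans eq (≡.sym toℕb))
      column-b : ∀ g → sweep u t g (toℕ b) ≡ sweep (suc u) t g (toℕ b) + t * sweep (suc u) t g (toℕ a)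
      column-b g rewrite toℕb | Fin.toℕ-fromℕ< (ℕ.<-trans (ℕ.n<1+n u) 1+u<k)
                       | sweep-> u t g (suc u) (ℕ.n<1+n u)
                       | sweep-≤ (suc u) t g (suc u) ℕ.≤-refl
                       | sweep-≤ (suc u) t g u (ℕ.n≤1+n u) = ≡.refl
    go : ∀ d u → k ≤ u ℕ.+ d → det R k (columnMatrix (sweep u t ∘ F)) ≈ det R k (columnMatrix F)
    go zero    u k≤u   = unchanged u (ℕ.m≤n⇒m≤1+n (≡.subst (k ≤_) (ℕ.+-identityʳ u) k≤u))
    go (suc d) u k≤u+d with k ℕ.≤? suc u
    ... | yes k≤1+u = unchanged u k≤1+u
    ... | no  k≰1+u = trans (step u (ℕ.≰⇒> k≰1+u)) (go d (suc u) (≡.subst (k ≤_) (ℕ.+-suc u d) k≤u+d))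

  infix 4 _≋_
  _≋_ : Seq → Seq → Set ℓ
  f ≋ g = ∀ k → f k ≈ g k

  iterate : (Seq → Seq) → ℕ → Seq → Seq
  iterate T zero    g = g
  iterate T (suc e) g = T (iterate T e g)

  module Stages (T : Seq → Seq) (T-cong : ∀ {f g} → f ≋ g → T f ≋ T g)
                (T-linear : ∀ t u v → T (λ k → u k + t * v k) ≋ (λ k → T u k + t * T v k))
                (τ : ℕ → Carrier) (v : Seq) where

    iterate-linear : ∀ e t g → iterate T e (λ k → T g k + t * g k) ≋ (λ k → iterate T (suc e) g k + t * iterate T e g k)
    iterate-linear zero    t g k = refl
    iterate-linear (suc e) t g k = trans (T-cong (iterate-linear e t g) k) (T-linear t (iterate T (suc e) g) (iterate T e g) k)

    stage : ℕ → Seq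
    stage zero    = v
    stage (suc s) = λ k → T (stage s) k + τ s * stage s k

    -- Column J after the sweeps with τ 0, …, τ (s ∸ 1), when column J started as T^J v.
    column : ℕ → ℕ → Seq
    column s J = iterate T (J ∸ s) (stage (J ℕ.⊓ s))

    column-≤ : ∀ s J → J ≤ s → column s J ≡ stage J
    column-≤ s J J≤s = ≡.cong₂ (λ e a → iterate T e (stage a)) (ℕ.m≤n⇒m∸n≡0 J≤s) (ℕ.m≤n⇒m⊓n≡m J≤s)

    column-≥ : ∀ s J → s ≤ J → column s J ≡ iterate T (J ∸ s) (stage s)
    column-≥ s J s≤J = ≡.cong (λ a → iterate T (J ∸ s) (stage a)) (ℕ.m≥n⇒m⊓n≡n s≤J)

    column-suc : ∀ s J k → column (suc s) J k ≈ sweep s (τ s) (λ J′ → column s J′ k) J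
    column-suc s J k with J ℕ.≤? s
    ... | yes J≤s = reflexive (≡.trans (≡.cong (λ g → g k) (column-≤ (suc s) J (ℕ.m≤n⇒m≤1+n J≤s)))
                                       (≡.sym (≡.cong (λ g → g k) (column-≤ s J J≤s))))
    column-suc s zero k | no 0≰s = ⊥-elim (0≰s ℕ.z≤n)
    column-suc s (suc J) k | no J+1≰s = begin
      column (suc s) (suc J) k
        ≡⟨ ≡.cong (λ g → g k) (column-≥ (suc s) (suc J) (ℕ.s≤s s≤J)) ⟩
      iterate T (J ∸ s) (stage (suc s)) k                               ≈⟨ iterate-linear (J ∸ s) (τ s) (stage s) k ⟩
      iterate T (suc (J ∸ s)) (stage s) k + τ s * iterate T (J ∸ s) (stage s) k
        ≡⟨ ≡.sym (≡.cong₂ (λ g h → g k + τ s * h k)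
                   (≡.trans (column-≥ s (suc J) (ℕ.m≤n⇒m≤1+n s≤J)) (≡.cong (λ e → iterate T e (stage s)) (ℕ.+-∸-assoc 1 s≤J)))
                   (column-≥ s J s≤J)) ⟩
      column s (suc J) k + τ s * column s J k ∎
      where
      s≤J : s ≤ J
      s≤J = ℕ.≤-pred (ℕ.≰⇒> J+1≰s)

  shift : Seq → Seq
  shift g zero    = 0#
  shift g (suc k) = g k

  pascalStep : Carrier → Seq → Seq
  pascalStep x g k = x * (g k + shift g k)

  pascalStep-cong : ∀ x {f g} → f ≋ g → pascalStep x f ≋ pascalStep x g
  pascalStep-cong x f≋g zero    = *-congˡ (+-congʳ (f≋g zero))
  pascalStep-cong x f≋g (suc k) = *-congˡ (+-cong (f≋g (suc k)) (f≋g k))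

  pascalStep-linear : ∀ x t u v → pascalStep x (λ k → u k + t * v k) ≋ (λ k → pascalStep x u k + t * pascalStep x v k)
  pascalStep-linear x t u v zero =
    solve 4 (λ x u t v → x :* ((u :+ t :* v) :+ con 0) := x :* (u :+ con 0) :+ t :* (x :* (v :+ con 0))) refl x (u 0) t (v 0)
  pascalStep-linear x t u v (suc k) =
    solve 6 (λ x u t v u′ v′ → x :* ((u :+ t :* v) :+ (u′ :+ t :* v′)) := x :* (u :+ u′) :+ t :* (x :* (v :+ v′)))
      refl x (u (suc k)) t (v (suc k)) (u k) (v k)

  binomialRow : ℕ → Seq
  binomialRow n k = ℕ→R R (n C k)

  ℕ→R-+ : ∀ a b → ℕ→R R (a ℕ.+ b) ≈ ℕ→R R a + ℕ→R R b
  ℕ→R-+ zero    b = sym (+-identityˡ _)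
  ℕ→R-+ (suc a) b = trans (+-congˡ (ℕ→R-+ a b)) (sym (+-assoc _ _ _))

  pascalStep-binomialRow : ∀ n x e k → iterate (pascalStep x) e (binomialRow n) k ≈ ℕ→R R ((n ℕ.+ e) C k) * pow R x e
  pascalStep-binomialRow n x zero k =
    trans (sym (*-identityʳ _)) (reflexive (≡.cong (λ a → ℕ→R R (a C k) * 1#) (≡.sym (ℕ.+-identityʳ n))))
  pascalStep-binomialRow n x (suc e) zero = begin
    x * (iterate (pascalStep x) e (binomialRow n) 0 + 0#) ≈⟨ *-congˡ (+-congʳ (pascalStep-binomialRow n x e 0)) ⟩
    x * (ℕ→R R 1 * pow R x e + 0#)
      ≈⟨ solve 2 (λ x p → x :* ((con 1 :+ con 0) :* p :+ con 0) := (con 1 :+ con 0) :* (x :* p)) refl x (pow R x e) ⟩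
    ℕ→R R 1 * pow R x (suc e)                              ∎
  pascalStep-binomialRow n x (suc e) (suc k) = begin
    x * (iterate (pascalStep x) e (binomialRow n) (suc k) + iterate (pascalStep x) e (binomialRow n) k)
      ≈⟨ *-congˡ (+-cong (pascalStep-binomialRow n x e (suc k)) (pascalStep-binomialRow n x e k)) ⟩
    x * (ℕ→R R ((n ℕ.+ e) C suc k) * pow R x e + ℕ→R R ((n ℕ.+ e) C k) * pow R x e)
      ≈⟨ solve 4 (λ x p a b → x :* (a :* p :+ b :* p) := (b :+ a) :* (x :* p)) refl x (pow R x e) _ _ ⟩
    (ℕ→R R ((n ℕ.+ e) C k) + ℕ→R R ((n ℕ.+ e) C suc k)) * pow R x (suc e)
      ≈⟨ *-congʳ (sym (ℕ→R-+ ((n ℕ.+ e) C k) ((n ℕ.+ e) C suc k))) ⟩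
    ℕ→R R ((n ℕ.+ e) C k ℕ.+ (n ℕ.+ e) C suc k) * pow R x (suc e)
      ≡⟨ ≡.cong (λ a → ℕ→R R a * pow R x (suc e))
           (≡.trans (nCk+nC[k+1]≡[n+1]C[k+1] (n ℕ.+ e) k) (≡.cong (_C suc k) (≡.sym (ℕ.+-suc n e)))) ⟩
    ℕ→R R ((n ℕ.+ suc e) C suc k) * pow R x (suc e) ∎

  VanishesBelow : ℕ → Seq → Set ℓ
  VanishesBelow c g = ∀ k → k < c → g k ≈ 0#

  pascalStep-minus-self : ∀ x g → (λ k → pascalStep x g k + - x * g k) ≋ (λ k → x * shift g k)
  pascalStep-minus-self x g k = begin
    x * (g k + shift g k) + - x * g k
      ≈⟨ solve 4 (λ x y g h → x :* (g :+ h) :+ y :* g := (x :+ y) :* g :+ x :* h) refl x (- x) (g k) (shift g k) ⟩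
    (x - x) * g k + x * shift g k        ≈⟨ +-congʳ (trans (*-congʳ (-‿inverseʳ x)) (zeroˡ (g k))) ⟩
    0# + x * shift g k                   ≈⟨ +-identityˡ _ ⟩
    x * shift g k                        ∎

  module PascalStages (x : Carrier) (τ : ℕ → Carrier) (v : Seq) where
    open Stages (pascalStep x) (pascalStep-cong x) (pascalStep-linear x) τ v public

    stage-vanishesBelow : ∀ c s d → VanishesBelow c (stage s) → VanishesBelow c (stage (s ℕ.+ d))
    stage-vanishesBelow c s zero    van = ≡.subst (λ a → VanishesBelow c (stage a)) (≡.sym (ℕ.+-identityʳ s)) van
    stage-vanishesBelow c s (suc d) van k k<c rewrite ℕ.+-suc s d = begin
      x * (g k + shift g k) + τ (s ℕ.+ d) * g k
        ≈⟨ +-cong (*-congˡ (+-cong (van′ k k<c) (shift-vanishes k k<c))) (*-congˡ (van′ k k<c)) ⟩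
      x * (0# + 0#) + τ (s ℕ.+ d) * 0#
        ≈⟨ solve 2 (λ x t → x :* (con 0 :+ con 0) :+ t :* con 0 := con 0) refl x (τ (s ℕ.+ d)) ⟩
      0#                                        ∎
      where
      g : Seq
      g = stage (s ℕ.+ d)
      van′ : VanishesBelow c g
      van′ = stage-vanishesBelow c s d van
      shift-vanishes : VanishesBelow c (shift g)
      shift-vanishes zero    _   = refl
      shift-vanishes (suc k) k<c = van′ k (ℕ.<-trans (ℕ.n<1+n k) k<c)

    stage-at-0 : ∀ s → stage s 0 ≈ ∏< s (λ t → x + τ t) * v 0
    stage-at-0 zero    = sym (*-identityˡ _)
    stage-at-0 (suc s) = begin
      x * (stage s 0 + 0#) + τ s * stage s 0
        ≈⟨ solve 3 (λ x g t → x :* (g :+ con 0) :+ t :* g := (x :+ t) :* g) refl x (stage s 0) (τ s) ⟩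
      (x + τ s) * stage s 0                         ≈⟨ *-congˡ (stage-at-0 s) ⟩
      (x + τ s) * (∏< s (λ t → x + τ t) * v 0)      ≈⟨ sym (*-assoc _ _ _) ⟩
      (x + τ s) * ∏< s (λ t → x + τ t) * v 0        ∎

    module Block (s₀ L : ℕ) (τ≈-x : ∀ c → c < L → τ (s₀ ℕ.+ c) ≈ - x) where

      stage-shifted : ∀ c → c < L → ∀ k → stage (s₀ ℕ.+ suc c) k ≈ x * shift (stage (s₀ ℕ.+ c)) k
      stage-shifted c c<L k rewrite ℕ.+-suc s₀ c =
        trans (+-congˡ (*-congʳ (τ≈-x c c<L))) (pascalStep-minus-self x (stage (s₀ ℕ.+ c)) k)

      block-vanishesBelow : ∀ c → c ≤ L → VanishesBelow c (stage (s₀ ℕ.+ c))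
      block-vanishesBelow (suc c) c<L zero    _     = trans (stage-shifted c c<L 0) (zeroʳ x)
      block-vanishesBelow (suc c) c<L (suc k) k<1+c =
        trans (stage-shifted c c<L (suc k)) (trans (*-congˡ (block-vanishesBelow c (ℕ.<⇒≤ c<L) k (ℕ.≤-pred k<1+c))) (zeroʳ x))

      block-diagonal : ∀ c → c ≤ L → ∀ k → stage (s₀ ℕ.+ c) (c ℕ.+ k) ≈ pow R x c * stage s₀ k
      block-diagonal zero    _   k = trans (reflexive (≡.cong (λ a → stage a k) (ℕ.+-identityʳ s₀))) (sym (*-identityˡ _))
      block-diagonal (suc c) c<L k = begin
        stage (s₀ ℕ.+ suc c) (suc c ℕ.+ k)      ≈⟨ stage-shifted c c<L (suc (c ℕ.+ k)) ⟩
        x * stage (s₀ ℕ.+ c) (c ℕ.+ k)          ≈⟨ *-congˡ (block-diagonal c (ℕ.<⇒≤ c<L) k) ⟩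
        x * (pow R x c * stage s₀ k)            ≈⟨ sym (*-assoc _ _ _) ⟩
        pow R x (suc c) * stage s₀ k            ∎

  det-stages : ∀ k (x : Fin k → Carrier) (κ : Fin k → ℕ) (τ : ℕ → Carrier) (v : Seq) s →
    det R k (columnMatrix (λ r J → PascalStages.column (x r) τ v s J (κ r))) ≈
    det R k (columnMatrix (λ r J → iterate (pascalStep (x r)) J v (κ r)))
  det-stages k x κ τ v zero =
    det-cong k (λ r j → reflexive (≡.cong (λ g → g (κ r)) (PascalStages.column-≥ (x r) τ v 0 (toℕ j) ℕ.z≤n)))
  det-stages k x κ τ v (suc s) = begin
    det R k (columnMatrix (λ r → column r (suc s)))
      ≈⟨ det-cong k (λ r j → PascalStages.column-suc (x r) τ v s (toℕ j) (κ r)) ⟩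
    det R k (columnMatrix (sweep s (τ s) ∘ (λ r → column r s)))
      ≈⟨ det-sweep k (λ r → column r s) s (τ s) ⟩
    det R k (columnMatrix (λ r → column r s))
      ≈⟨ det-stages k x κ τ v s ⟩
    det R k (columnMatrix (λ r J → iterate (pascalStep (x r)) J v (κ r))) ∎
    where
    column : Fin k → ℕ → Seq
    column r s J = PascalStages.column (x r) τ v s J (κ r)

  ∏<-pow : ∀ x l → ∏< l (pow R x) ≈ pow R x (l ℕ.* (l ∸ 1) / 2)
  ∏<-pow x zero    = refl
  ∏<-pow x (suc l) = begin
    pow R x l * ∏< l (pow R x)              ≈⟨ *-congˡ (∏<-pow x l) ⟩
    pow R x l * pow R x (l ℕ.* (l ∸ 1) / 2) ≈⟨ sym (pow-+ x l _) ⟩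
    pow R x (l ℕ.+ l ℕ.* (l ∸ 1) / 2)       ≡⟨ ≡.cong (pow R x) (n+n[n∸1]/2≡[n+1]n/2 l) ⟩
    pow R x (suc l ℕ.* l / 2)               ∎

  -- The value 0# beyond m is junk; only extend X (toℕ i) matters.
  extend : ∀ {m} → (Fin m → Carrier) → ℕ → Carrier
  extend {m} X t with t ℕ.<? m
  ... | yes t<m = X (Fin.fromℕ< t<m)
  ... | no  _   = 0#

  extend-toℕ : ∀ {m} (X : Fin m → Carrier) i → extend X (toℕ i) ≈ X i
  extend-toℕ {m} X i with toℕ i ℕ.<? m
  ... | yes i<m = reflexive (≡.cong X (Fin.fromℕ<-toℕ i i<m))
  ... | no  i≮m = ⊥-elim (i≮m (Fin.toℕ<n i))

  ∏-DiffFactor-column : ∀ {m} (X : Fin m → Carrier) l (i : Fin m) →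
    ∏ R m (λ j → DiffFactor R X l j i) ≈ ∏< (toℕ i) (λ a → pow R (X i - extend X a) (l ℕ.* l))
  ∏-DiffFactor-column {m} X l i = begin
    ∏ R m (λ j → DiffFactor R X l j i)      ≈⟨ ∏-cong m DiffFactor≈factor ⟩
    ∏ R m (factor ∘ toℕ)                    ≈⟨ ∏-toℕ m factor ⟩
    ∏< m factor
      ≡⟨ ≡.cong (λ s → ∏< s factor) (≡.sym (ℕ.m+[n∸m]≡n (ℕ.<⇒≤ (Fin.toℕ<n i)))) ⟩
    ∏< (toℕ i ℕ.+ (m ∸ toℕ i)) factor       ≈⟨ ∏<-split (toℕ i) (m ∸ toℕ i) factor ⟩
    ∏< (m ∸ toℕ i) (λ t → factor (toℕ i ℕ.+ t)) * ∏< (toℕ i) factor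
      ≈⟨ *-cong (trans (∏<-cong (m ∸ toℕ i) (λ t _ → factor-≥ (toℕ i ℕ.+ t) (ℕ.≤⇒≯ (ℕ.m≤m+n (toℕ i) t))))
                       (trans (∏<-const (m ∸ toℕ i) 1#) (pow-1# (m ∸ toℕ i))))
                (∏<-cong (toℕ i) factor-<) ⟩
    1# * ∏< (toℕ i) (λ a → pow R (X i - extend X a) (l ℕ.* l)) ≈⟨ *-identityˡ _ ⟩
    ∏< (toℕ i) (λ a → pow R (X i - extend X a) (l ℕ.* l))      ∎
    where
    factor : ℕ → Carrier
    factor t with t ℕ.<? toℕ i
    ... | yes _ = pow R (X i - extend X t) (l ℕ.* l)
    ... | no  _ = 1#
    factor-< : ∀ t → t < toℕ i → factor t ≈ pow R (X i - extend X t) (l ℕ.* l)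
    factor-< t t<i with t ℕ.<? toℕ i
    ... | yes _   = refl
    ... | no  t≮i = ⊥-elim (t≮i t<i)
    factor-≥ : ∀ t → ¬ t < toℕ i → factor t ≈ 1#
    factor-≥ t t≮i with t ℕ.<? toℕ i
    ... | yes t<i = ⊥-elim (t≮i t<i)
    ... | no  _   = refl
    DiffFactor≈factor : ∀ j → DiffFactor R X l j i ≈ factor (toℕ j)
    DiffFactor≈factor j with toℕ j ℕ.<? toℕ i
    ... | yes _ = pow-cong (l ℕ.* l) (+-congˡ (-‿cong (sym (extend-toℕ X j))))
    ... | no  _ = refl

  module MatA (m l′ n : ℕ) (X : Fin m → Carrier) where
    l N : ℕ
    l = suc l′
    N = m ℕ.* l

    α : ℕ → Carrier
    α t = extend X (t / l)

    α-block : ∀ a c → c < l → α (l ℕ.* a ℕ.+ c) ≡ extend X a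
    α-block a c c<l = ≡.cong (extend X) ([n*q+r]/n≡q l a c c<l)

    block : Fin N → Fin m
    block r = proj₁ (Fin.remQuot {m} l r)

    offset : Fin N → Fin l
    offset r = proj₂ (Fin.remQuot {m} l r)

    toℕ-row : ∀ r → toℕ r ≡ l ℕ.* toℕ (block r) ℕ.+ toℕ (offset r)
    toℕ-row r = ≡.trans (≡.cong toℕ (≡.sym (Fin.combine-remQuot {m} l r))) (Fin.toℕ-combine (block r) (offset r))

    module Row (r : Fin N) where
      open PascalStages (X (block r)) (λ t → - α t) (binomialRow n) public
      x : Carrier
      x = X (block r)
      k s₀ : ℕ
      k = toℕ (offset r)
      s₀ = l ℕ.* toℕ (block r)
      k<l : k < l
      k<l = Fin.toℕ<n (offset r)
      open Block s₀ l (λ c c<l → -‿cong (trans (reflexive (α-block (toℕ (block r)) c c<l)) (extend-toℕ X (block r)))) public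

    swept : Fin N → Seq
    swept r J = Row.stage r J (Row.k r)

    det-matA≈det-swept : det R N (matA R m l n X) ≈ det R N (columnMatrix swept)
    det-matA≈det-swept = begin
      det R N (matA R m l n X)
        ≈⟨ det-cong N (λ r j → sym (pascalStep-binomialRow n (Row.x r) (toℕ j) (Row.k r))) ⟩
      det R N (columnMatrix (λ r J → iterate (pascalStep (Row.x r)) J (binomialRow n) (Row.k r)))
        ≈⟨ sym (det-stages N Row.x Row.k (λ t → - α t) (binomialRow n) N) ⟩
      det R N (columnMatrix (λ r J → Row.column r N J (Row.k r)))
        ≈⟨ det-cong N (λ r j → reflexive (≡.cong (λ g → g (Row.k r)) (Row.column-≤ r N (toℕ j) (ℕ.<⇒≤ (Fin.toℕ<n j))))) ⟩
      det R N (columnMatrix swept) ∎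

    swept-upper : ∀ (r j : Fin N) → toℕ r < toℕ j → swept r (toℕ j) ≈ 0#
    swept-upper r j r<j = ≡.subst (λ J → stage J k ≈ 0#) (ℕ.m+[n∸m]≡n s₀+k<j)
        (stage-vanishesBelow (suc k) (s₀ ℕ.+ suc k) (toℕ j ∸ (s₀ ℕ.+ suc k)) (block-vanishesBelow (suc k) k<l) k (ℕ.n<1+n k))
      where
      open Row r
      s₀+k<j : s₀ ℕ.+ suc k ≤ toℕ j
      s₀+k<j = ≡.subst (_≤ toℕ j) (≡.trans (≡.cong suc (toℕ-row r)) (≡.sym (ℕ.+-suc s₀ k))) r<j

    diagonal : Fin m → Fin l → Carrier
    diagonal i k = pow R (X i) (toℕ k) * ∏< (l ℕ.* toℕ i) (λ t → X i - α t)

    swept-diagonal : ∀ r → swept r (toℕ r) ≈ diagonal (block r) (offset r)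
    swept-diagonal r = begin
      stage (toℕ r) k                                            ≡⟨ ≡.cong₂ stage (toℕ-row r) (≡.sym (ℕ.+-identityʳ k)) ⟩
      stage (s₀ ℕ.+ k) (k ℕ.+ 0)                                 ≈⟨ block-diagonal k (ℕ.<⇒≤ k<l) 0 ⟩
      pow R x k * stage s₀ 0                                     ≈⟨ *-congˡ (stage-at-0 s₀) ⟩
      pow R x k * (∏< s₀ (λ t → x - α t) * (1# + 0#))
        ≈⟨ *-congˡ (trans (*-congˡ (+-identityʳ 1#)) (*-identityʳ _)) ⟩
      diagonal (block r) (offset r)                              ∎
      where open Row r

    ∏-diagonal : ∀ i → ∏ R l (diagonal i) ≈ pow R (X i) (l ℕ.* (l ∸ 1) / 2) * ∏ R m (λ j → DiffFactor R X l j i)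
    ∏-diagonal i = begin
      ∏ R l (diagonal i)                                            ≈⟨ ∏-distrib-* l (pow R (X i) ∘ toℕ) (λ _ → Q) ⟩
      ∏ R l (pow R (X i) ∘ toℕ) * ∏ R l (λ _ → Q)
        ≈⟨ *-cong (trans (∏-toℕ l (pow R (X i))) (∏<-pow (X i) l)) (∏-const l Q) ⟩
      pow R (X i) (l ℕ.* (l ∸ 1) / 2) * pow R Q l                    ≈⟨ *-congˡ (trans Q^l (sym (∏-DiffFactor-column X l i))) ⟩
      pow R (X i) (l ℕ.* (l ∸ 1) / 2) * ∏ R m (λ j → DiffFactor R X l j i) ∎
      where
      Q : Carrier
      Q = ∏< (l ℕ.* toℕ i) (λ t → X i - α t)
      Q^l : pow R Q l ≈ ∏< (toℕ i) (λ a → pow R (X i - extend X a) (l ℕ.* l))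
      Q^l = begin
        pow R Q l
          ≈⟨ pow-cong l (trans (∏<-blocks l (toℕ i) (λ t → X i - α t))
               (∏<-cong (toℕ i) (λ a _ → trans (∏<-cong l (λ c c<l → +-congˡ (-‿cong (reflexive (α-block a c c<l)))))
                                                (∏<-const l (X i - extend X a))))) ⟩
        pow R (∏< (toℕ i) (λ a → pow R (X i - extend X a) l)) l ≈⟨ pow-∏< (toℕ i) _ l ⟩
        ∏< (toℕ i) (λ a → pow R (pow R (X i - extend X a) l) l)
          ≈⟨ ∏<-cong (toℕ i) (λ a _ → sym (pow-* (X i - extend X a) l l)) ⟩
        ∏< (toℕ i) (λ a → pow R (X i - extend X a) (l ℕ.* l))   ∎

    det-matA : det R N (matA R m l n X) ≈
               ∏ R m (λ i → pow R (X i) (l ℕ.* (l ∸ 1) / 2)) * ∏ R m (λ i → ∏ R m (λ j → DiffFactor R X l i j))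
    det-matA = begin
      det R N (matA R m l n X)                       ≈⟨ det-matA≈det-swept ⟩
      det R N (columnMatrix swept)                   ≈⟨ det-lowerTriangular N (columnMatrix swept) swept-upper ⟩
      ∏ R N (λ r → swept r (toℕ r))                  ≈⟨ ∏-cong N swept-diagonal ⟩
      ∏ R N (λ r → diagonal (block r) (offset r))    ≈⟨ ∏-combine m l _ ⟩
      ∏ R m (λ i → ∏ R l (λ k → diagonal (block (combine i k)) (offset (combine i k))))
        ≈⟨ ∏-cong m (λ i → ∏-cong l (λ k → reflexive (≡.cong (uncurry diagonal) (Fin.remQuot-combine i k)))) ⟩
      ∏ R m (λ i → ∏ R l (diagonal i))               ≈⟨ ∏-cong m ∏-diagonal ⟩
      ∏ R m (λ i → pow R (X i) (l ℕ.* (l ∸ 1) / 2) * ∏ R m (λ j → DiffFactor R X l j i))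
        ≈⟨ ∏-distrib-* m _ _ ⟩
      ∏ R m (λ i → pow R (X i) (l ℕ.* (l ∸ 1) / 2)) * ∏ R m (λ i → ∏ R m (λ j → DiffFactor R X l j i))
        ≈⟨ *-congˡ (∏-comm m m (λ i j → DiffFactor R X l j i)) ⟩
      ∏ R m (λ i → pow R (X i) (l ℕ.* (l ∸ 1) / 2)) * ∏ R m (λ i → ∏ R m (λ j → DiffFactor R X l i j)) ∎

theorem2 : ∀ {c ℓ : Level} (R : CommutativeRing c ℓ) (m l n : ℕ) →
           1 ≤ m → 1 ≤ l → l ≤ n → (X : Fin m → CommutativeRing.Carrier R) →
           CommutativeRing._≈_ R (det R (m ℕ.* l) (matA R m l n X))
             (CommutativeRing._*_ R
               (∏ R m (λ i → pow R (X i) ((l ℕ.* (l ∸ 1)) / 2)))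
               (∏ R m (λ i → ∏ R m (λ j → DiffFactor R X l i j))))
theorem2 R m (suc l′) n _ _ _ X = MatA.det-matA R m l′ n X
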